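{- Let $\mathcal{F}$ be a disjointness-compliable family of subsets of $V$ all of whose cores are singletons, and let $T$ be the set of terminals. Let $A\in\mathcal{F}$ and $B\subseteq V\setminus T$. Then (i) $A\setminus B\in\mathcal{F}$; (ii) if $\mathcal{F}$ is also symmetric (i.e. proper), then also $A\cup B\in\mathcal{F}$.
   Context: $\mathcal{F}$ is disjointness-compliable if $A'\subseteq A\in\mathcal{F}$ implies $A'\in\mathcal{F}$ or $A\setminus A'\in\mathcal{F}$; symmetric means $A\in\mathcal{F}$ implies $V\setminus A\in\mathcal{F}$, and proper means disjointness-compliable and symmetric. An $\mathcal{F}$-core is an inclusion-minimal member of $\mathcal{F}$. Under the assumption that all $\mathcal{F}$-cores are singletons, a terminal is a node $t$ with $\{t\}$ an $\mathcal{F}$-core, and $T$ is the set of terminals. -}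

module Defs where

open import Level using (Level; suc; _⊔_)
open import Data.Nat using (ℕ)
open import Data.Fin using (Fin)
open import Data.Fin.Subset using (Subset; _⊆_; _∈_; _∉_; _∪_; _─_; ∁; ⁅_⁆)
open import Data.Product using (_×_; ∃)
open import Data.Sum using (_⊎_)
open import Relation.Binary.PropositionalEquality using (_≡_)
open import Relation.Nullary using (¬_)

-- The ground set V is Fin n; a family of subsets of V is a predicate on Subset n.
Family : ℕ → Set₁
Family n = Subset n → Set

module _ {n : ℕ} (𝓕 : Family n) where

  DisjointnessCompliable : Set
  DisjointnessCompliable =
    ∀ (A A' : Subset n) → A' ⊆ A → 𝓕 A → 𝓕 A' ⊎ 𝓕 (A ─ A')

  Symmetric : Set
  Symmetric = ∀ (A : Subset n) → 𝓕 A → 𝓕 (∁ A)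

  Proper : Set
  Proper = DisjointnessCompliable × Symmetric

  IsCore : Subset n → Set
  IsCore C = 𝓕 C × (∀ (C' : Subset n) → C' ⊆ C → 𝓕 C' → C' ≡ C)

  CoresAreSingletons : Set
  CoresAreSingletons = ∀ (C : Subset n) → IsCore C → ∃ λ (v : Fin n) → C ≡ ⁅ v ⁆

  IsTerminal : Fin n → Set
  IsTerminal t = IsCore ⁅ t ⁆

  AvoidsTerminals : Subset n → Set
  AvoidsTerminals B = ∀ {v : Fin n} → v ∈ B → ¬ IsTerminal v

-- A member of 𝓕 contained in {v} is nonempty (otherwise ∅ would be a core, and
-- cores are singletons), so it is {v} itself, and then v is a terminal.  Hence
-- for a non-terminal v, splitting A ∈ 𝓕 along A ∩ {v} ⊆ A forces A ∖ {v} ∈ 𝓕.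
-- Removing the elements of B one at a time gives (i); for (ii) apply (i) to
-- V ∖ A and use V ∖ ((V ∖ A) ∖ B) = A ∪ B.
module Submission where

open import Defs
open import Data.Nat using (ℕ)
open import Data.Fin.Subset using (Subset; _∪_; _─_)
open import Data.Product using (_×_)

open import Data.Empty using (⊥-elim)
open import Data.Fin using (Fin)
open import Data.Fin.Subset
  using (_⊆_; _⊂_; _∈_; _∩_; _-_; ∁; ⁅_⁆; ⊥; inside; outside; Nonempty; Empty)
open import Data.Fin.Subset.Induction using (⊂-wellFounded; Acc; acc)
open import Data.Fin.Subset.Properties
open import Data.Product using (_,_)
open import Data.Sum using (inj₁; inj₂; [_,_])
open import Data.Vec using ([]; _∷_)
open import Function using (id)
open import Relation.Nullary using (¬_; yes; no)
open import Relation.Binary.PropositionalEquality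
  using (_≡_; refl; sym; cong; subst; module ≡-Reasoning)

private
  variable
    n : ℕ
    x : Fin n
    p q : Subset n

x∈p⇒⁅x⁆⊆p : x ∈ p → ⁅ x ⁆ ⊆ p
x∈p⇒⁅x⁆⊆p {x = x} {p = p} x∈p y∈⁅x⁆ = subst (_∈ p) (sym (x∈⁅y⁆⇒x≡y x y∈⁅x⁆)) x∈p

p⊆⁅x⁆⇒p≡⁅x⁆ : Nonempty p → p ⊆ ⁅ x ⁆ → p ≡ ⁅ x ⁆
p⊆⁅x⁆⇒p≡⁅x⁆ {x = x} (y , y∈p) p⊆⁅x⁆ =
  ⊆-antisym p⊆⁅x⁆ (x∈p⇒⁅x⁆⊆p (subst (_∈ _) (x∈⁅y⁆⇒x≡y x (p⊆⁅x⁆ y∈p)) y∈p))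

p⊆q⇒p∪q≡q : p ⊆ q → p ∪ q ≡ q
p⊆q⇒p∪q≡q {p = p} {q = q} p⊆q =
  ⊆-antisym (λ x∈p∪q → [ p⊆q , id ] (x∈p∪q⁻ p q x∈p∪q)) (λ x∈q → x∈p∪q⁺ (inj₂ x∈q))

p∩q≡∅⇒p─q≡p : Empty (p ∩ q) → p ─ q ≡ p
p∩q≡∅⇒p─q≡p {p = p} {q = q} p∩q≡∅ =
  ⊆-antisym (p─q⊆p p q)
    (λ x∈p → x∈p∧x∉q⇒x∈p─q x∈p (λ x∈q → p∩q≡∅ (_ , x∈p∩q⁺ (x∈p , x∈q))))

x∈q⇒p-x─q≡p─q : ∀ (p : Subset n) → x ∈ q → p - x ─ q ≡ p ─ q
x∈q⇒p-x─q≡p─q {x = x} {q = q} p x∈q = begin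
  p ─ ⁅ x ⁆ ─ q    ≡⟨ p─q─r≡p─q∪r p ⁅ x ⁆ q ⟩
  p ─ (⁅ x ⁆ ∪ q)  ≡⟨ cong (p ─_) (p⊆q⇒p∪q≡q (x∈p⇒⁅x⁆⊆p x∈q)) ⟩
  p ─ q            ∎
  where open ≡-Reasoning

p─p∩q≡p─q : ∀ (p q : Subset n) → p ─ (p ∩ q) ≡ p ─ q
p─p∩q≡p─q []            []            = refl
p─p∩q≡p─q (inside  ∷ p) (inside  ∷ q) = cong (_ ∷_) (p─p∩q≡p─q p q)
p─p∩q≡p─q (inside  ∷ p) (outside ∷ q) = cong (_ ∷_) (p─p∩q≡p─q p q)
p─p∩q≡p─q (outside ∷ p) (inside  ∷ q) = cong (_ ∷_) (p─p∩q≡p─q p q)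
p─p∩q≡p─q (outside ∷ p) (outside ∷ q) = cong (_ ∷_) (p─p∩q≡p─q p q)

∁[∁p─q]≡p∪q : ∀ (p q : Subset n) → ∁ (∁ p ─ q) ≡ p ∪ q
∁[∁p─q]≡p∪q []            []            = refl
∁[∁p─q]≡p∪q (inside  ∷ p) (inside  ∷ q) = cong (_ ∷_) (∁[∁p─q]≡p∪q p q)
∁[∁p─q]≡p∪q (inside  ∷ p) (outside ∷ q) = cong (_ ∷_) (∁[∁p─q]≡p∪q p q)
∁[∁p─q]≡p∪q (outside ∷ p) (inside  ∷ q) = cong (_ ∷_) (∁[∁p─q]≡p∪q p q)
∁[∁p─q]≡p∪q (outside ∷ p) (outside ∷ q) = cong (_ ∷_) (∁[∁p─q]≡p∪q p q)

module _ (P : Subset n → Set) (B : Subset n)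
         (P-remove : ∀ {A x} → x ∈ B → P A → P (A - x)) where

  ─-closure : ∀ {A} → P A → P (A ─ B)
  ─-closure {A} = go A (⊂-wellFounded A)
    where
    go : ∀ A → Acc _⊂_ A → P A → P (A ─ B)
    go A (acc smaller) PA with nonempty? (A ∩ B)
    ... | no A∩B≡∅ = subst P (sym (p∩q≡∅⇒p─q≡p A∩B≡∅)) PA
    ... | yes (x , x∈A∩B) =
      let x∈A , x∈B = x∈p∩q⁻ A B x∈A∩B
      in subst P (x∈q⇒p-x─q≡p─q A x∈B)
           (go (A - x) (smaller (x∈p⇒p-x⊂p x∈A)) (P-remove x∈B PA))

module _ (𝓕 : Family n) (compliable : DisjointnessCompliable 𝓕)
         (singleton-cores : CoresAreSingletons 𝓕) where

  ¬𝓕⊥ : ¬ 𝓕 ⊥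
  ¬𝓕⊥ 𝓕⊥ with singleton-cores ⊥ (𝓕⊥ , λ C C⊆⊥ _ → ⊆-antisym C⊆⊥ ⊥⊆)
  ... | v , ⊥≡⁅v⁆ = ∉⊥ (subst (v ∈_) (sym ⊥≡⁅v⁆) (x∈⁅x⁆ v))

  𝓕⇒Nonempty : ∀ {S} → 𝓕 S → Nonempty S
  𝓕⇒Nonempty {S} 𝓕S with nonempty? S
  ... | yes S≢∅ = S≢∅
  ... | no  S≡∅ = ⊥-elim (¬𝓕⊥ (subst 𝓕 (Empty-unique S≡∅) 𝓕S))

  𝓕∋S⊆⁅v⁆⇒S≡⁅v⁆ : ∀ {S v} → S ⊆ ⁅ v ⁆ → 𝓕 S → S ≡ ⁅ v ⁆
  𝓕∋S⊆⁅v⁆⇒S≡⁅v⁆ S⊆⁅v⁆ 𝓕S = p⊆⁅x⁆⇒p≡⁅x⁆ (𝓕⇒Nonempty 𝓕S) S⊆⁅v⁆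

  𝓕∋⁅v⁆⇒terminal : ∀ {v} → 𝓕 ⁅ v ⁆ → IsTerminal 𝓕 v
  𝓕∋⁅v⁆⇒terminal 𝓕⁅v⁆ = 𝓕⁅v⁆ , λ C C⊆⁅v⁆ 𝓕C → 𝓕∋S⊆⁅v⁆⇒S≡⁅v⁆ C⊆⁅v⁆ 𝓕C

  remove-nonterminal : ∀ {A v} → ¬ IsTerminal 𝓕 v → 𝓕 A → 𝓕 (A - v)
  remove-nonterminal {A} {v} ¬terminal 𝓕A
    with compliable A (A ∩ ⁅ v ⁆) (p∩q⊆p A ⁅ v ⁆) 𝓕A
  ... | inj₁ 𝓕A∩v = ⊥-elim (¬terminal (𝓕∋⁅v⁆⇒terminal
          (subst 𝓕 (𝓕∋S⊆⁅v⁆⇒S≡⁅v⁆ (p∩q⊆q A ⁅ v ⁆) 𝓕A∩v) 𝓕A∩v)))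
  ... | inj₂ 𝓕A─A∩v = subst 𝓕 (p─p∩q≡p─q A ⁅ v ⁆) 𝓕A─A∩v

lemma10 : ∀ {n : ℕ} (𝓕 : Family n) → DisjointnessCompliable 𝓕 → CoresAreSingletons 𝓕 →
    ∀ (A B : Subset n) → 𝓕 A → AvoidsTerminals 𝓕 B →
      𝓕 (A ─ B) × (Symmetric 𝓕 → 𝓕 (A ∪ B))
lemma10 𝓕 compliable singleton-cores A B 𝓕A B-avoids-T =
  𝓕[─B] 𝓕A ,
  λ symmetric → subst 𝓕 (∁[∁p─q]≡p∪q A B) (symmetric _ (𝓕[─B] (symmetric A 𝓕A)))
  where
  𝓕[─B] : ∀ {C} → 𝓕 C → 𝓕 (C ─ B)
  𝓕[─B] = ─-closure 𝓕 B
    (λ x∈B → remove-nonterminal 𝓕 compliable singleton-cores (B-avoids-T x∈B))
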